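{- Let $n\ge s\ge 0$ be integers, let $G\in\mathfrak{E}(n,s)$, let $H$ be a graph, and let $(\varphi,\psi)$ be an $H$-mould for $G$. If $x,y\in V(H)$ are distinct, then $\psi(x)\cap\psi(y)=\emptyset$.
   Context: All graphs are finite and simple. For integers $n\ge s\ge 0$, $\mathrm{ex}(n,s)$ is the maximum number of edges in a triangle-free graph on $n$ vertices with independence number at most $s$, and $\mathfrak{E}(n,s)$ is the family of triangle-free graphs $G$ on $n$ vertices with $\alpha(G)\le s$ and exactly $\mathrm{ex}(n,s)$ edges. The fortress $\mathcal{F}_G$ of $G\in\mathfrak{E}(n,s)$ is the graph whose vertices are the independent sets $X\subseteq V(G)$ with $|X|=s$, two such sets being adjacent iff they are disjoint. An imprint of a graph $H$ in $G$ is an injective map $\varphi\colon V(H)\to V(\mathcal{F}_G)$ such that for all $x,y\in V(H)$: $xy\in E(H)$ iff $\varphi(x)\varphi(y)\in E(\mathcal{F}_G)$. An $H$-mould for $G$ is a pair $(\varphi,\psi)$ of maps $V(H)\to\mathcal{P}(V(G))$ such that $\varphi$ is an imprint of $H$ in $G$ and for every $x\in V(H)$, $\psi(x)$ is an independent set of size $3s-n$ in $G$ and every vertex of $\psi(x)$ is adjacent to every vertex of $\varphi(x)$ (equivalently, every $z\in\psi(x)$ has neighbourhood $N_G(z)=\varphi(x)$). -}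

module Defs where

open import Data.Nat using (ℕ; _+_; _*_; _<_; _≤_)
open import Data.Nat.Properties using (_<?_)
open import Data.Bool using (Bool; true; false; _∧_; if_then_else_)
open import Data.Fin using (Fin; toℕ)
open import Data.Fin.Subset using (Subset; _∈_; ∣_∣)
open import Data.List using (List; map; allFin)
open import Data.Nat.ListAction using (sum)
open import Data.Product using (Σ; _×_)
open import Data.Empty using (⊥)
open import Relation.Nullary using (¬_; does)
open import Relation.Binary.PropositionalEquality using (_≡_; _≢_)
open import Function.Bundles using (_⇔_)

record Graph (n : ℕ) : Set where
  field
    adj   : Fin n → Fin n → Bool
    sym   : ∀ i j → adj i j ≡ adj j i
    irrefl : ∀ i → adj i i ≡ false
open Graph public

edges : ∀ {n} → Graph n → ℕ
edges {n} G = sum (map (λ i → sum (map (λ j →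
  if does (toℕ i <? toℕ j) ∧ adj G i j then 1 else 0) (allFin n))) (allFin n))

TriangleFree : ∀ {n} → Graph n → Set
TriangleFree {n} G = (i j k : Fin n) →
  adj G i j ≡ true → adj G j k ≡ true → adj G i k ≡ true → ⊥

Independent : ∀ {n} → Graph n → Subset n → Set
Independent {n} G X = (i j : Fin n) → i ∈ X → j ∈ X → adj G i j ≡ false

IndepAtMost : ∀ {n} → Graph n → ℕ → Set
IndepAtMost {n} G s = (X : Subset n) → Independent G X → ∣ X ∣ ≤ s

-- G ∈ 𝔈(n,s): triangle-free, α(G) ≤ s, and the number of edges equals
-- ex(n,s), i.e. is maximum among all such graphs on n vertices.
Extremal : (n s : ℕ) → Graph n → Set
Extremal n s G = TriangleFree G × IndepAtMost G s ×
  ((G' : Graph n) → TriangleFree G' → IndepAtMost G' s → edges G' ≤ edges G)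

FortressVertex : ∀ {n} → Graph n → ℕ → Subset n → Set
FortressVertex G s X = Independent G X × ∣ X ∣ ≡ s

Disjoint : ∀ {n} → Subset n → Subset n → Set
Disjoint {n} X Y = (i : Fin n) → i ∈ X → i ∈ Y → ⊥

FortressAdj : ∀ {n} → Subset n → Subset n → Set
FortressAdj X Y = X ≢ Y × Disjoint X Y

Imprint : ∀ {n m} → (s : ℕ) → Graph n → Graph m → (Fin m → Subset n) → Set
Imprint {n} {m} s G H φ =
  ((x : Fin m) → FortressVertex G s (φ x)) ×
  ((x y : Fin m) → φ x ≡ φ y → x ≡ y) ×
  ((x y : Fin m) → (adj H x y ≡ true) ⇔ FortressAdj (φ x) (φ y))

-- An H-mould (φ , ψ) for G; |ψ x| = 3s - n stated as |ψ x| + n = 3s.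
Mould : ∀ {n m} → (s : ℕ) → Graph n → Graph m →
        (Fin m → Subset n) → (Fin m → Subset n) → Set
Mould {n} {m} s G H φ ψ =
  Imprint s G H φ ×
  ((x : Fin m) → Independent G (ψ x) × ∣ ψ x ∣ + n ≡ 3 * s ×
     ((z v : Fin n) → z ∈ ψ x → v ∈ φ x → adj G z v ≡ true))

-- A common vertex z of ψ x and ψ y would be adjacent to every vertex of φ x ∪ φ y.
-- In a triangle-free graph a neighbourhood is independent, so |φ x ∪ φ y| ≤ s = |φ x| = |φ y|;
-- hence φ x = φ x ∪ φ y = φ y, contradicting injectivity of the imprint φ.
module Submission where

open import Defs
open import Data.Nat using (ℕ; _≤_; s≤s)
open import Data.Nat.Properties using (≤-trans; ≤-reflexive; 1+n≰n)
open import Data.Fin using (Fin)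
open import Data.Fin.Subset using (Subset; _∩_; _∪_; _⊆_; inside; outside)
  renaming (⊥ to ∅; ∣_∣ to card; _∈_ to _∈ₛ_)
open import Data.Fin.Subset.Properties
  using (Empty-unique; x∈p∩q⁻; p⊆p∪q; q⊆p∪q; x∈p∪q⁻; drop-∷-⊆; p⊆q⇒∣p∣≤∣q∣)
open import Data.Vec using ([]; _∷_; here)
open import Data.Bool using (true; false)
open import Data.Product using (_,_; _×_; proj₂)
open import Data.Sum using (inj₁; inj₂)
open import Data.Empty using (⊥; ⊥-elim)
open import Relation.Binary.PropositionalEquality using (_≡_; _≢_; refl; trans; cong)
  renaming (sym to ≡-sym)

⊆∧∣q∣≤∣p∣⇒p≡q : ∀ {n} {p q : Subset n} → p ⊆ q → card q ≤ card p → p ≡ q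
⊆∧∣q∣≤∣p∣⇒p≡q {p = []}          {[]}          _   _         = refl
⊆∧∣q∣≤∣p∣⇒p≡q {p = outside ∷ p} {outside ∷ q} p⊆q ∣q∣≤∣p∣   =
  cong (outside ∷_) (⊆∧∣q∣≤∣p∣⇒p≡q (drop-∷-⊆ p⊆q) ∣q∣≤∣p∣)
⊆∧∣q∣≤∣p∣⇒p≡q {p = inside ∷ p}  {inside ∷ q}  p⊆q (s≤s ∣q∣≤∣p∣) =
  cong (inside ∷_) (⊆∧∣q∣≤∣p∣⇒p≡q (drop-∷-⊆ p⊆q) ∣q∣≤∣p∣)
⊆∧∣q∣≤∣p∣⇒p≡q {p = inside ∷ p}  {outside ∷ q} p⊆q _ with p⊆q here
... | ()
⊆∧∣q∣≤∣p∣⇒p≡q {p = outside ∷ p} {inside ∷ q}  p⊆q ∣q∣≤∣p∣   =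
  ⊥-elim (1+n≰n (≤-trans ∣q∣≤∣p∣ (p⊆q⇒∣p∣≤∣q∣ (drop-∷-⊆ p⊆q))))

⊆∧∣q∣≤s≡∣p∣⇒p≡q : ∀ {n s} {p q : Subset n} → p ⊆ q → card q ≤ s → card p ≡ s → p ≡ q
⊆∧∣q∣≤s≡∣p∣⇒p≡q p⊆q ∣q∣≤s ∣p∣≡s = ⊆∧∣q∣≤∣p∣⇒p≡q p⊆q (≤-trans ∣q∣≤s (≤-reflexive (≡-sym ∣p∣≡s)))

module _ {n : ℕ} (G : Graph n) where

  Dominated : Fin n → Subset n → Set
  Dominated z X = (v : Fin n) → v ∈ₛ X → adj G z v ≡ true

  dominated-independent : ∀ z {X} → TriangleFree G → Dominated z X → Independent G X
  dominated-independent z tf z⊳X i j i∈X j∈X with adj G i j in ij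
  ... | false = refl
  ... | true  = ⊥-elim (tf z i j (z⊳X i i∈X) ij (z⊳X j j∈X))

  dominated-∪ : ∀ z {X Y} → Dominated z X → Dominated z Y → Dominated z (X ∪ Y)
  dominated-∪ z {X} {Y} z⊳X z⊳Y v v∈X∪Y with x∈p∪q⁻ X Y v∈X∪Y
  ... | inj₁ v∈X = z⊳X v v∈X
  ... | inj₂ v∈Y = z⊳Y v v∈Y

  co-dominated-fortress-vertices-equal : ∀ {s} z {X Y} →
    TriangleFree G → IndepAtMost G s → FortressVertex G s X → FortressVertex G s Y →
    Dominated z X → Dominated z Y → X ≡ Y
  co-dominated-fortress-vertices-equal {s} z {X} {Y} tf α≤s (_ , ∣X∣≡s) (_ , ∣Y∣≡s) z⊳X z⊳Y =
    trans (⊆∧∣q∣≤s≡∣p∣⇒p≡q (p⊆p∪q Y) ∣X∪Y∣≤s ∣X∣≡s)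
          (≡-sym (⊆∧∣q∣≤s≡∣p∣⇒p≡q (q⊆p∪q X Y) ∣X∪Y∣≤s ∣Y∣≡s))
    where
    ∣X∪Y∣≤s : card (X ∪ Y) ≤ s
    ∣X∪Y∣≤s = α≤s (X ∪ Y) (dominated-independent z tf (dominated-∪ z z⊳X z⊳Y))

fact2p4 : (n s : ℕ) → s ≤ n → (G : Graph n) → Extremal n s G →
    {m : ℕ} (H : Graph m) (φ ψ : Fin m → Subset n) → Mould s G H φ ψ →
    (x y : Fin m) → x ≢ y → ψ x ∩ ψ y ≡ ∅
fact2p4 n s _ G (tf , α≤s , _) H φ ψ ((vertex , injective , _) , mould) x y x≢y =
  Empty-unique λ { (z , z∈ψx∩ψy) → no-common-vertex z (x∈p∩q⁻ (ψ x) (ψ y) z∈ψx∩ψy) }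
  where
  ψ-dominates : ∀ {z} w → z ∈ₛ ψ w → Dominated G z (φ w)
  ψ-dominates {z} w z∈ψw v = proj₂ (proj₂ (mould w)) z v z∈ψw

  no-common-vertex : ∀ z → z ∈ₛ ψ x × z ∈ₛ ψ y → ⊥
  no-common-vertex z (z∈ψx , z∈ψy) = x≢y (injective x y
    (co-dominated-fortress-vertices-equal G z tf α≤s (vertex x) (vertex y)
      (ψ-dominates x z∈ψx) (ψ-dominates y z∈ψy)))
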